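{- Let $q=17$. There exists a $(167,11)$-arc in $\operatorname{PG}(2,17)$; consequently $m_{11}(2,17)\ge 167$.
   Context: $\operatorname{PG}(2,q)$ denotes the projective plane over the finite field $\operatorname{GF}(q)$, whose points and lines are the 1- and 2-dimensional subspaces of $\operatorname{GF}(q)^3$. An $(n,r)$-arc in $\operatorname{PG}(2,q)$ is a set $\mathcal{B}$ of $n$ points of $\operatorname{PG}(2,q)$ such that every line of $\operatorname{PG}(2,q)$ contains at most $r$ points of $\mathcal{B}$ and at least one line contains exactly $r$ points of $\mathcal{B}$. $m_r(2,q)$ denotes the maximum $n$ such that an $(n,r)$-arc in $\operatorname{PG}(2,q)$ exists. -}

module Defs where

open import Data.Nat using (ℕ; _+_; _*_; _≤_)
open import Data.Nat.DivMod using (_mod_)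
open import Data.Fin using (Fin; toℕ)
open import Data.Fin.Properties using (_≟_)
open import Data.Product using (_×_; _,_; Σ; ∃)
open import Data.List using (List; length; filter)
open import Data.List.Relation.Unary.All using (All)
open import Data.List.Relation.Unary.AllPairs using (AllPairs)
open import Relation.Binary.PropositionalEquality using (_≡_; _≢_)
open import Relation.Nullary using (¬_)

module PrimeField (q : ℕ) .{{_ : Data.Nat.NonZero q}} where

  F : Set
  F = Fin q

  0F : F
  0F = 0 mod q

  _+F_ : F → F → F
  a +F b = (toℕ a + toℕ b) mod q

  _*F_ : F → F → F
  a *F b = (toℕ a * toℕ b) mod q

  V3 : Set
  V3 = F × F × F

  zeroV : V3
  zeroV = 0F , 0F , 0F

  NonZeroV : V3 → Set
  NonZeroV v = v ≢ zeroV

  scale : F → V3 → V3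
  scale c (x , y , z) = c *F x , c *F y , c *F z

  -- u and v span the same 1-dimensional subspace (i.e. same projective point)
  SamePoint : V3 → V3 → Set
  SamePoint u v = Σ F λ c → (c ≢ 0F) × (scale c u ≡ v)

  -- bilinear pairing; the point <v> lies on the line ker(l) (a 2-dim subspace,
  -- every 2-dim subspace of GF(q)^3 arises this way from a nonzero l)
  dot : V3 → V3 → F
  dot (a , b , c) (x , y , z) = ((a *F x) +F (b *F y)) +F (c *F z)

  record PointSet : Set where
    field
      reps     : List V3
      nonzero  : All NonZeroV reps
      distinct : AllPairs (λ u v → ¬ SamePoint u v) reps

  open PointSet public

  onLine : PointSet → V3 → ℕ
  onLine B l = length (filter (λ v → dot v l ≟ 0F) (reps B))

  IsArc : ℕ → ℕ → PointSet → Set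
  IsArc n r B =
    (length (reps B) ≡ n)
    × ((l : V3) → NonZeroV l → onLine B l ≤ r)
    × (Σ V3 λ l → NonZeroV l × (onLine B l ≡ r))

module GF17 = PrimeField 17

PointSet17 : Set
PointSet17 = GF17.PointSet

IsArc17 : ℕ → ℕ → PointSet17 → Set
IsArc17 = GF17.IsArc

-- The arc is given explicitly by 167 homogeneous coordinate triples:
-- 136 affine points (1 : a : b), eight for each a ∈ GF(17), together
-- with 31 further points.
module Submission where

open import Defs
open import Data.Nat using (ℕ; NonZero; _≤_; _≤?_)
open import Data.Nat.DivMod using (_mod_)
open import Data.Fin.Properties as Fin using ()
open import Data.Product using (Σ; _,_; _×_)
open import Data.Product.Properties using (≡-dec)
open import Data.List using (List; []; _∷_; length; map; concatMap; _++_)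
open import Data.List.Relation.Unary.All using (all?)
open import Data.List.Relation.Unary.AllPairs using (allPairs?)
open import Relation.Binary.Definitions using (DecidableEquality)
open import Relation.Binary.PropositionalEquality using (_≡_; refl)
open import Relation.Nullary using (Dec; ¬?; map′; _×-dec_; _→-dec_)
open import Relation.Nullary.Decidable using (True; toWitness)

module Decide (q : ℕ) .{{_ : NonZero q}} where

  open PrimeField q

  _≟V_ : DecidableEquality V3
  _≟V_ = ≡-dec Fin._≟_ (≡-dec Fin._≟_ Fin._≟_)

  nonZeroV? : (v : V3) → Dec (NonZeroV v)
  nonZeroV? v = ¬? (v ≟V zeroV)

  samePoint? : (u v : V3) → Dec (SamePoint u v)
  samePoint? u v = Fin.any? (λ c → ¬? (c Fin.≟ 0F) ×-dec (scale c u ≟V v))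

  allV3? : {P : V3 → Set} → ((v : V3) → Dec (P v)) → Dec ((v : V3) → P v)
  allV3? P? =
    map′ (λ all (a , b , c) → all a b c) (λ all a b c → all (a , b , c))
         (Fin.all? λ a → Fin.all? λ b → Fin.all? λ c → P? (a , b , c))

  lineBound? : (B : PointSet) (r : ℕ) →
               Dec ((l : V3) → NonZeroV l → onLine B l ≤ r)
  lineBound? B r = allV3? (λ l → nonZeroV? l →-dec (onLine B l ≤? r))

  pointSet : (vs : List V3) →
             True (all? nonZeroV? vs) →
             True (allPairs? (λ u v → ¬? (samePoint? u v)) vs) →
             PointSet
  pointSet vs nonzero distinct = record
    { reps     = vs
    ; nonzero  = toWitness nonzero
    ; distinct = toWitness distinct
    }

  arc : (B : PointSet) (r : ℕ) →
        ((l : V3) → NonZeroV l → onLine B l ≤ r) →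
        (l : V3) → NonZeroV l → onLine B l ≡ r →
        IsArc (length (reps B)) r B
  arc B r bound l l≢0 onLine≡r = refl , bound , l , l≢0 , onLine≡r

open GF17
open Decide 17

point : ℕ → ℕ → ℕ → V3
point x y z = x mod 17 , y mod 17 , z mod 17

-- For each a ∈ GF(17), the eight values b with (1 : a : b) in the arc.
-- (Row a coincides with row −a.)
affineRows : List (ℕ × List ℕ)
affineRows =
    (0  , 3 ∷ 5 ∷ 6 ∷ 7 ∷ 10 ∷ 11 ∷ 12 ∷ 14 ∷ [])
  ∷ (1  , 4 ∷ 6 ∷ 7 ∷ 8 ∷ 11 ∷ 12 ∷ 13 ∷ 15 ∷ [])
  ∷ (2  , 1 ∷ 7 ∷ 9 ∷ 10 ∷ 11 ∷ 14 ∷ 15 ∷ 16 ∷ [])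
  ∷ (3  , 2 ∷ 3 ∷ 4 ∷ 6 ∷ 12 ∷ 14 ∷ 15 ∷ 16 ∷ [])
  ∷ (4  , 2 ∷ 4 ∷ 5 ∷ 6 ∷ 9 ∷ 10 ∷ 11 ∷ 13 ∷ [])
  ∷ (5  , 1 ∷ 2 ∷ 3 ∷ 5 ∷ 11 ∷ 13 ∷ 14 ∷ 15 ∷ [])
  ∷ (6  , 5 ∷ 7 ∷ 8 ∷ 9 ∷ 12 ∷ 13 ∷ 14 ∷ 16 ∷ [])
  ∷ (7  , 1 ∷ 3 ∷ 4 ∷ 5 ∷ 8 ∷ 9 ∷ 10 ∷ 12 ∷ [])
  ∷ (8  , 1 ∷ 2 ∷ 3 ∷ 6 ∷ 7 ∷ 8 ∷ 10 ∷ 16 ∷ [])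
  ∷ (9  , 1 ∷ 2 ∷ 3 ∷ 6 ∷ 7 ∷ 8 ∷ 10 ∷ 16 ∷ [])
  ∷ (10 , 1 ∷ 3 ∷ 4 ∷ 5 ∷ 8 ∷ 9 ∷ 10 ∷ 12 ∷ [])
  ∷ (11 , 5 ∷ 7 ∷ 8 ∷ 9 ∷ 12 ∷ 13 ∷ 14 ∷ 16 ∷ [])
  ∷ (12 , 1 ∷ 2 ∷ 3 ∷ 5 ∷ 11 ∷ 13 ∷ 14 ∷ 15 ∷ [])
  ∷ (13 , 2 ∷ 4 ∷ 5 ∷ 6 ∷ 9 ∷ 10 ∷ 11 ∷ 13 ∷ [])
  ∷ (14 , 2 ∷ 3 ∷ 4 ∷ 6 ∷ 12 ∷ 14 ∷ 15 ∷ 16 ∷ [])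
  ∷ (15 , 1 ∷ 7 ∷ 9 ∷ 10 ∷ 11 ∷ 14 ∷ 15 ∷ 16 ∷ [])
  ∷ (16 , 4 ∷ 6 ∷ 7 ∷ 8 ∷ 11 ∷ 12 ∷ 13 ∷ 15 ∷ [])
  ∷ []

affinePoints : List V3
affinePoints = concatMap (λ (a , bs) → map (point 1 a) bs) affineRows

extraPoints : List V3
extraPoints =
    point 0 0 1  ∷ point 1 10 15 ∷ point 0 1 0  ∷ point 1 7 6
  ∷ point 0 1 1  ∷ point 1 14 10 ∷ point 0 1 5  ∷ point 1 6 3
  ∷ point 0 1 8  ∷ point 1 5 0   ∷ point 0 1 9  ∷ point 1 3 11
  ∷ point 0 1 12 ∷ point 1 11 1  ∷ point 0 1 14 ∷ point 1 0 2
  ∷ point 0 1 16 ∷ point 1 12 4  ∷ point 1 0 0  ∷ point 1 4 16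
  ∷ point 1 1 16 ∷ point 1 15 8  ∷ point 1 2 4  ∷ point 1 11 2
  ∷ point 1 2 13 ∷ point 1 16 5  ∷ point 1 4 7  ∷ point 1 8 12
  ∷ point 1 9 9  ∷ point 1 13 14 ∷ point 0 1 3
  ∷ []

arc167 : PointSet17
arc167 = pointSet (affinePoints ++ extraPoints) _ _

-- The line y = 0 contains the eight points (1 : 0 : b) together with
-- (0 : 0 : 1), (1 : 0 : 2) and (1 : 0 : 0).
lineY0 : V3
lineY0 = point 0 1 0

mainTheorem1 : Σ PointSet17 (IsArc17 167 11)
mainTheorem1 =
  arc167 ,
  arc arc167 11 (toWitness {a? = lineBound? arc167 11} _)
      lineY0 (toWitness {a? = nonZeroV? lineY0} _) refl
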